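{- Let $P:\mathcal{C}^{op}\to\mathbf{InfSL}$ be a tripos with effective quotients and comprehensive diagonals. Then $\mathcal{C}$ has coequalizers.
   Context: A primary doctrine is a functor $P:\mathcal{C}^{op}\to\mathbf{InfSL}$, $\mathcal{C}$ with finite products, $\mathbf{InfSL}$ the category of inf-semilattices and meet-preserving maps; $P_f=P(f)$, $\top_A$ the top of $P(A)$. $P$ is elementary if for each $A$ there is $\delta_A\in P(A\times A)$ such that for every $X$ the map $\alpha\mapsto P_{\langle pr_1,pr_2\rangle}(\alpha)\wedge P_{\langle pr_2,pr_3\rangle}(\delta_A)$, $P(X\times A)\to P(X\times A\times A)$, is left adjoint to $P_{\langle pr_1,pr_2,pr_2\rangle}$. $P$ is existential if each $P_{pr}$ along a product projection has a left adjoint satisfying Beck–Chevalley and Frobenius reciprocity. A first order doctrine is an existential elementary doctrine that is implicational, disjunctive (finite distributive joins preserved by reindexing) and universal (right adjoints to $P_{pr}$ satisfying Beck–Chevalley). $P$ has weak power objects if for every $A$ there are $\mathcal{P}A$ and $\in_A\in P(A\times\mathcal{P}A)$ such that every $\phi\in P(A\times Y)$ equals $P_{id_A\times\chi}(\in_A)$ for some $\chi:Y\to\mathcal{P}A$. A tripos is a first order doctrine with weak power objects. $P$ has comprehensive diagonals if for $f,g:X\to A$: $f=g$ iff $\top_X=P_{\langle f,g\rangle}(\delta_A)$. A $P$-equivalence relation on $A$ is a reflexive ($\delta_A\le\rho$), symmetric and transitive $\rho\in P(A\times A)$. $P$ has quotients if for each $P$-equivalence relation $\rho$ on $A$ there is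 $q:A\to A/\rho$ with $\rho\le P_{q\times q}(\delta_{A/\rho})$ such that every $f:A\to Y$ with $\rho\le P_{f\times f}(\delta_Y)$ factors uniquely as $f=hq$; quotients are effective if moreover $\rho=P_{q\times q}(\delta_{A/\rho})$. -}

module Defs where

open import Level using (Level; _⊔_) renaming (suc to lsuc)
open import Relation.Binary using (Rel; IsEquivalence)
open import Relation.Binary.Lattice.Bundles using (BoundedMeetSemilattice)
open import Data.Product using (Σ; _,_) renaming (_×_ to _∧∧_)

_⇔'_ : ∀ {a b} → Set a → Set b → Set (a ⊔ b)
X ⇔' Y = (X → Y) ∧∧ (Y → X)

record Category (o ℓ e : Level) : Set (lsuc (o ⊔ ℓ ⊔ e)) where
  infixr 9 _∘_
  infix  4 _≈_
  field
    Obj       : Set o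
    Hom       : Obj → Obj → Set ℓ
    _≈_       : ∀ {A B} → Rel (Hom A B) e
    ≈-equiv   : ∀ {A B} → IsEquivalence (_≈_ {A} {B})
    id        : ∀ {A} → Hom A A
    _∘_       : ∀ {A B C} → Hom B C → Hom A B → Hom A C
    ∘-resp-≈  : ∀ {A B C} {f f′ : Hom B C} {g g′ : Hom A B} →
                f ≈ f′ → g ≈ g′ → f ∘ g ≈ f′ ∘ g′
    assoc     : ∀ {A B C D} {f : Hom A B} {g : Hom B C} {h : Hom C D} →
                (h ∘ g) ∘ f ≈ h ∘ (g ∘ f)
    identityˡ : ∀ {A B} {f : Hom A B} → id ∘ f ≈ f
    identityʳ : ∀ {A B} {f : Hom A B} → f ∘ id ≈ f

record FiniteProducts {o ℓ e} (C : Category o ℓ e) : Set (o ⊔ ℓ ⊔ e) where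
  open Category C
  infixr 7 _⊗_
  field
    𝟙        : Obj
    !        : ∀ {A} → Hom A 𝟙
    !-unique : ∀ {A} (f : Hom A 𝟙) → f ≈ !
    _⊗_      : Obj → Obj → Obj
    π₁       : ∀ {A B} → Hom (A ⊗ B) A
    π₂       : ∀ {A B} → Hom (A ⊗ B) B
    ⟨_,_⟩    : ∀ {X A B} → Hom X A → Hom X B → Hom X (A ⊗ B)
    π₁∘⟨⟩    : ∀ {X A B} {f : Hom X A} {g : Hom X B} → π₁ ∘ ⟨ f , g ⟩ ≈ f
    π₂∘⟨⟩    : ∀ {X A B} {f : Hom X A} {g : Hom X B} → π₂ ∘ ⟨ f , g ⟩ ≈ g
    ⟨⟩-unique : ∀ {X A B} {f : Hom X A} {g : Hom X B} {h : Hom X (A ⊗ B)} →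
                π₁ ∘ h ≈ f → π₂ ∘ h ≈ g → h ≈ ⟨ f , g ⟩

  _⁂_ : ∀ {A B A′ B′} → Hom A A′ → Hom B B′ → Hom (A ⊗ B) (A′ ⊗ B′)
  f ⁂ g = ⟨ f ∘ π₁ , g ∘ π₂ ⟩

record PrimaryDoctrine {o ℓ e} (C : Category o ℓ e) (Pr : FiniteProducts C)
                       (p q r : Level) : Set (o ⊔ ℓ ⊔ e ⊔ lsuc (p ⊔ q ⊔ r)) where
  open Category C
  field
    Fib : Obj → BoundedMeetSemilattice p q r

  ∣_∣ : Obj → Set p
  ∣ A ∣ = BoundedMeetSemilattice.Carrier (Fib A)

  leq : (A : Obj) → ∣ A ∣ → ∣ A ∣ → Set r
  leq A = BoundedMeetSemilattice._≤_ (Fib A)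
  syntax leq A x y = x ≤[ A ] y

  eqv : (A : Obj) → ∣ A ∣ → ∣ A ∣ → Set q
  eqv A = BoundedMeetSemilattice._≈_ (Fib A)
  syntax eqv A x y = x ≡[ A ] y

  meet : (A : Obj) → ∣ A ∣ → ∣ A ∣ → ∣ A ∣
  meet A = BoundedMeetSemilattice._∧_ (Fib A)

  top : (A : Obj) → ∣ A ∣
  top A = BoundedMeetSemilattice.⊤ (Fib A)

  field
    reindex    : ∀ {A B} → Hom A B → ∣ B ∣ → ∣ A ∣
    reindex-cong : ∀ {A B} (f : Hom A B) {x y : ∣ B ∣} →
                   x ≡[ B ] y → reindex f x ≡[ A ] reindex f y
    reindex-∧  : ∀ {A B} (f : Hom A B) (x y : ∣ B ∣) →
                 reindex f (meet B x y) ≡[ A ] meet A (reindex f x) (reindex f y)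
    reindex-⊤  : ∀ {A B} (f : Hom A B) → reindex f (top B) ≡[ A ] top A
    reindex-resp : ∀ {A B} {f g : Hom A B} (x : ∣ B ∣) →
                   f ≈ g → reindex f x ≡[ A ] reindex g x
    reindex-id : ∀ {A} (x : ∣ A ∣) → reindex id x ≡[ A ] x
    reindex-∘  : ∀ {A B C′} (f : Hom A B) (g : Hom B C′) (x : ∣ C′ ∣) →
                 reindex (g ∘ f) x ≡[ A ] reindex f (reindex g x)

module _ {o ℓ e p q r} {C : Category o ℓ e} {Pr : FiniteProducts C}
         (D : PrimaryDoctrine C Pr p q r) where
  open Category C
  open FiniteProducts Pr
  open PrimaryDoctrine D

  private
    P = reindex

  record Elementary : Set (o ⊔ ℓ ⊔ e ⊔ p ⊔ q ⊔ r) where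
    field
      δ : (A : Obj) → ∣ A ⊗ A ∣
      -- on X × A × A = (X ⊗ A) ⊗ A :
      --   <pr1,pr2> = π₁ , <pr2,pr3> = ⟨ π₂ ∘ π₁ , π₂ ⟩ , <pr1,pr2,pr2> = ⟨ id , π₂ ⟩
      δ-adj : ∀ (X A : Obj) (α : ∣ X ⊗ A ∣) (β : ∣ (X ⊗ A) ⊗ A ∣) →
              (meet ((X ⊗ A) ⊗ A) (P π₁ α) (P ⟨ π₂ ∘ π₁ , π₂ ⟩ (δ A)) ≤[ (X ⊗ A) ⊗ A ] β)
              ⇔' (α ≤[ X ⊗ A ] P ⟨ id , π₂ ⟩ β)

  record Existential : Set (o ⊔ ℓ ⊔ e ⊔ p ⊔ q ⊔ r) where
    field
      ∃ : ∀ {X A} → ∣ X ⊗ A ∣ → ∣ X ∣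
      ∃-adj : ∀ {X A} (α : ∣ X ⊗ A ∣) (β : ∣ X ∣) →
              (∃ α ≤[ X ] β) ⇔' (α ≤[ X ⊗ A ] P π₁ β)
      ∃-BC : ∀ {Y X A} (f : Hom Y X) (α : ∣ X ⊗ A ∣) →
             P f (∃ α) ≡[ Y ] ∃ (P (f ⁂ id) α)
      ∃-Frobenius : ∀ {X A} (α : ∣ X ⊗ A ∣) (β : ∣ X ∣) →
             ∃ (meet (X ⊗ A) α (P π₁ β)) ≡[ X ] meet X (∃ α) β

  record Universal : Set (o ⊔ ℓ ⊔ e ⊔ p ⊔ q ⊔ r) where
    field
      ∀′ : ∀ {X A} → ∣ X ⊗ A ∣ → ∣ X ∣
      ∀-adj : ∀ {X A} (α : ∣ X ⊗ A ∣) (β : ∣ X ∣) →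
              (P π₁ β ≤[ X ⊗ A ] α) ⇔' (β ≤[ X ] ∀′ α)
      ∀-BC : ∀ {Y X A} (f : Hom Y X) (α : ∣ X ⊗ A ∣) →
             P f (∀′ α) ≡[ Y ] ∀′ (P (f ⁂ id) α)

  record Implicational : Set (o ⊔ ℓ ⊔ e ⊔ p ⊔ q ⊔ r) where
    field
      imp : ∀ {A} → ∣ A ∣ → ∣ A ∣ → ∣ A ∣
      imp-adj : ∀ {A} (x y z : ∣ A ∣) →
                (meet A x y ≤[ A ] z) ⇔' (x ≤[ A ] imp y z)
      imp-reindex : ∀ {A B} (f : Hom A B) (x y : ∣ B ∣) →
                P f (imp x y) ≡[ A ] imp (P f x) (P f y)

  record Disjunctive : Set (o ⊔ ℓ ⊔ e ⊔ p ⊔ q ⊔ r) where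
    field
      bot  : (A : Obj) → ∣ A ∣
      join : (A : Obj) → ∣ A ∣ → ∣ A ∣ → ∣ A ∣
      bot-min : ∀ {A} (x : ∣ A ∣) → bot A ≤[ A ] x
      join-inl : ∀ {A} (x y : ∣ A ∣) → x ≤[ A ] join A x y
      join-inr : ∀ {A} (x y : ∣ A ∣) → y ≤[ A ] join A x y
      join-lub : ∀ {A} (x y z : ∣ A ∣) → x ≤[ A ] z → y ≤[ A ] z → join A x y ≤[ A ] z
      distrib : ∀ {A} (x y z : ∣ A ∣) →
                meet A x (join A y z) ≤[ A ] join A (meet A x y) (meet A x z)
      bot-reindex : ∀ {A B} (f : Hom A B) → P f (bot B) ≡[ A ] bot A
      join-reindex : ∀ {A B} (f : Hom A B) (x y : ∣ B ∣) →
                P f (join B x y) ≡[ A ] join A (P f x) (P f y)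

  record WeakPowerObjects : Set (o ⊔ ℓ ⊔ e ⊔ p ⊔ q ⊔ r) where
    field
      𝒫  : Obj → Obj
      ∈  : (A : Obj) → ∣ A ⊗ 𝒫 A ∣
      classify : ∀ {A Y} (φ : ∣ A ⊗ Y ∣) →
                 Σ (Hom Y (𝒫 A)) λ χ → φ ≡[ A ⊗ Y ] P (id ⁂ χ) (∈ A)

  record Tripos : Set (o ⊔ ℓ ⊔ e ⊔ p ⊔ q ⊔ r) where
    field
      elementary    : Elementary
      existential   : Existential
      implicational : Implicational
      disjunctive   : Disjunctive
      universal     : Universal
      weakPower     : WeakPowerObjects

  module _ (E : Elementary) where
    open Elementary E

    ComprehensiveDiagonals : Set (o ⊔ ℓ ⊔ e ⊔ q)
    ComprehensiveDiagonals = ∀ {X A} (f g : Hom X A) →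
      (f ≈ g) ⇔' (top X ≡[ X ] P ⟨ f , g ⟩ (δ A))

    record IsPEquivalence (A : Obj) (ρ : ∣ A ⊗ A ∣) : Set r where
      field
        reflexive  : δ A ≤[ A ⊗ A ] ρ
        symmetric  : ρ ≤[ A ⊗ A ] P ⟨ π₂ , π₁ ⟩ ρ
        -- on A × A × A = (A ⊗ A) ⊗ A :
        --   <pr1,pr2> = π₁ , <pr2,pr3> = ⟨ π₂ ∘ π₁ , π₂ ⟩ , <pr1,pr3> = ⟨ π₁ ∘ π₁ , π₂ ⟩
        transitive : meet ((A ⊗ A) ⊗ A) (P π₁ ρ) (P ⟨ π₂ ∘ π₁ , π₂ ⟩ ρ)
                       ≤[ (A ⊗ A) ⊗ A ] P ⟨ π₁ ∘ π₁ , π₂ ⟩ ρ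

    record Quotient (A : Obj) (ρ : ∣ A ⊗ A ∣) : Set (o ⊔ ℓ ⊔ e ⊔ r) where
      field
        A/ρ    : Obj
        quot   : Hom A A/ρ
        quot-resp : ρ ≤[ A ⊗ A ] P (quot ⁂ quot) (δ A/ρ)
        factor : ∀ {Y} (f : Hom A Y) → ρ ≤[ A ⊗ A ] P (f ⁂ f) (δ Y) → Hom A/ρ Y
        factor-comm : ∀ {Y} (f : Hom A Y) (c : ρ ≤[ A ⊗ A ] P (f ⁂ f) (δ Y)) →
                      f ≈ factor f c ∘ quot
        factor-unique : ∀ {Y} (f : Hom A Y) (c : ρ ≤[ A ⊗ A ] P (f ⁂ f) (δ Y))
                        (h : Hom A/ρ Y) → f ≈ h ∘ quot → h ≈ factor f c

    HasEffectiveQuotients : Set (o ⊔ ℓ ⊔ e ⊔ p ⊔ q ⊔ r)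
    HasEffectiveQuotients = ∀ (A : Obj) (ρ : ∣ A ⊗ A ∣) → IsPEquivalence A ρ →
      Σ (Quotient A ρ) λ Q →
        ρ ≡[ A ⊗ A ] P (Quotient.quot Q ⁂ Quotient.quot Q) (δ (Quotient.A/ρ Q))

module _ {o ℓ e} (C : Category o ℓ e) where
  open Category C

  record Coequalizer {A B : Obj} (f g : Hom A B) : Set (o ⊔ ℓ ⊔ e) where
    field
      obj    : Obj
      arr    : Hom B obj
      equality : arr ∘ f ≈ arr ∘ g
      coequalize : ∀ {Z} (h : Hom B Z) → h ∘ f ≈ h ∘ g → Hom obj Z
      universal  : ∀ {Z} (h : Hom B Z) (eq : h ∘ f ≈ h ∘ g) → h ≈ coequalize h eq ∘ arr
      unique     : ∀ {Z} (h : Hom B Z) (eq : h ∘ f ≈ h ∘ g) (u : Hom obj Z) →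
                   h ≈ u ∘ arr → u ≈ coequalize h eq

  HasCoequalizers : Set (o ⊔ ℓ ⊔ e)
  HasCoequalizers = ∀ {A B : Obj} (f g : Hom A B) → Coequalizer f g

{-# OPTIONS --safe #-}
module Submission where

-- For f , g : A → B call W ∈ 𝒫 B saturated when f a ∈ W ↔ g a ∈ W for all a, and let
-- ρ(x , y) say that x and y lie in the same saturated subsets. This is a P-equivalence
-- relation relating f a to g a, so, by comprehensive diagonals, the quotient map of ρ
-- identifies f and g. If h ∘ f = h ∘ g then every class {x ∣ h x = h y}, which the weak
-- power object provides, is saturated; hence ρ lies below the kernel of h, which is what
-- is needed for h to factor uniquely through the quotient.

open import Defs
open import Level using (Level)
open import Data.Product using (_,_; proj₁; proj₂)
open import Relation.Binary using (IsEquivalence)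
open import Relation.Binary.Lattice.Bundles using (BoundedMeetSemilattice)
import Relation.Binary.Lattice.Properties.MeetSemilattice as MeetSemilatticeProperties
import Relation.Binary.Reasoning.PartialOrder as PosetReasoning

module Products {o ℓ e} {C : Category o ℓ e} (Pr : FiniteProducts C) where
  open Category C
  open FiniteProducts Pr

  ≈-refl : ∀ {A B} {f : Hom A B} → f ≈ f
  ≈-refl = IsEquivalence.refl ≈-equiv

  ≈-sym : ∀ {A B} {f g : Hom A B} → f ≈ g → g ≈ f
  ≈-sym = IsEquivalence.sym ≈-equiv

  ≈-trans : ∀ {A B} {f g h : Hom A B} → f ≈ g → g ≈ h → f ≈ h
  ≈-trans = IsEquivalence.trans ≈-equiv

  ⟨⟩-cong : ∀ {X A B} {f f′ : Hom X A} {g g′ : Hom X B} →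
            f ≈ f′ → g ≈ g′ → ⟨ f , g ⟩ ≈ ⟨ f′ , g′ ⟩
  ⟨⟩-cong f≈f′ g≈g′ = ⟨⟩-unique (≈-trans π₁∘⟨⟩ f≈f′) (≈-trans π₂∘⟨⟩ g≈g′)

  ⟨⟩∘ : ∀ {X Y A B} {f : Hom Y A} {g : Hom Y B} {h : Hom X Y} →
        ⟨ f , g ⟩ ∘ h ≈ ⟨ f ∘ h , g ∘ h ⟩
  ⟨⟩∘ = ⟨⟩-unique (≈-trans (≈-sym assoc) (∘-resp-≈ π₁∘⟨⟩ ≈-refl))
                  (≈-trans (≈-sym assoc) (∘-resp-≈ π₂∘⟨⟩ ≈-refl))

  ⟨⟩∘≈⟨⟩ : ∀ {X Y A B} {f : Hom Y A} {g : Hom Y B} {h : Hom X Y} {f′ : Hom X A} {g′ : Hom X B} →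
           f ∘ h ≈ f′ → g ∘ h ≈ g′ → ⟨ f , g ⟩ ∘ h ≈ ⟨ f′ , g′ ⟩
  ⟨⟩∘≈⟨⟩ f∘h≈f′ g∘h≈g′ = ≈-trans ⟨⟩∘ (⟨⟩-cong f∘h≈f′ g∘h≈g′)

  ∘π₁∘⟨⟩ : ∀ {X A B Z} {h : Hom A Z} {f : Hom X A} {g : Hom X B} → (h ∘ π₁) ∘ ⟨ f , g ⟩ ≈ h ∘ f
  ∘π₁∘⟨⟩ = ≈-trans assoc (∘-resp-≈ ≈-refl π₁∘⟨⟩)

  ∘π₂∘⟨⟩ : ∀ {X A B Z} {h : Hom B Z} {f : Hom X A} {g : Hom X B} → (h ∘ π₂) ∘ ⟨ f , g ⟩ ≈ h ∘ g
  ∘π₂∘⟨⟩ = ≈-trans assoc (∘-resp-≈ ≈-refl π₂∘⟨⟩)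

  ⟨π₁,π₂⟩≈id : ∀ {A B} → ⟨ π₁ , π₂ ⟩ ≈ id {A ⊗ B}
  ⟨π₁,π₂⟩≈id = ≈-sym (⟨⟩-unique identityʳ identityʳ)

module Doctrine {o ℓ e p q r} {C : Category o ℓ e} {Pr : FiniteProducts C}
                (D : PrimaryDoctrine C Pr p q r) where
  open Category C
  open FiniteProducts Pr
  open PrimaryDoctrine D
  open Products Pr

  module Fibre (A : Obj) where
    open BoundedMeetSemilattice (Fib A) public hiding (_≈_)
    open MeetSemilatticeProperties meetSemilattice public using (∧-monotonic; ∧-cong)
    open PosetReasoning poset public

  reindex-mono : ∀ {A B} (f : Hom A B) {x y : ∣ B ∣} → x ≤[ B ] y → reindex f x ≤[ A ] reindex f y
  reindex-mono {A} {B} f {x} {y} x≤y = begin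
    reindex f x                        ≈⟨ reindex-cong f x∧y≈x ⟨
    reindex f (meet B x y)             ≈⟨ reindex-∧ f x y ⟩
    meet A (reindex f x) (reindex f y) ≤⟨ x∧y≤y _ _ ⟩
    reindex f y                        ∎
    where
      open Fibre A
      x∧y≈x : meet B x y ≡[ B ] x
      x∧y≈x = Fibre.antisym B (Fibre.x∧y≤x B x y) (Fibre.∧-greatest B (Fibre.refl B) x≤y)

  reindex-∘≈ : ∀ {X Y Z} (f : Hom X Y) (g : Hom Y Z) {h : Hom X Z} → g ∘ f ≈ h → (x : ∣ Z ∣) →
               reindex f (reindex g x) ≡[ X ] reindex h x
  reindex-∘≈ {X} f g g∘f≈h x =
    Fibre.Eq.trans X (Fibre.Eq.sym X (reindex-∘ f g x)) (reindex-resp x g∘f≈h)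

  ⊤≤-reindex : ∀ {A B} (f : Hom A B) {x : ∣ B ∣} → top B ≤[ B ] x → top A ≤[ A ] reindex f x
  ⊤≤-reindex {A} f ⊤≤x = Fibre.≤-respˡ-≈ A (reindex-⊤ f) (reindex-mono f ⊤≤x)

  reindex-square : ∀ {X Y Y′ Z} (f : Hom X Y) (g : Hom Y Z) (f′ : Hom X Y′) (g′ : Hom Y′ Z) →
                   g ∘ f ≈ g′ ∘ f′ → (x : ∣ Z ∣) →
                   reindex f (reindex g x) ≡[ X ] reindex f′ (reindex g′ x)
  reindex-square {X} f g f′ g′ square x =
    Fibre.Eq.trans X (reindex-∘≈ f g square x) (Fibre.Eq.sym X (reindex-∘≈ f′ g′ ≈-refl x))

  reindex-∘≈id : ∀ {X Y} (f : Hom X Y) (g : Hom Y X) → g ∘ f ≈ id → (x : ∣ X ∣) →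
                 reindex f (reindex g x) ≡[ X ] x
  reindex-∘≈id {X} f g g∘f≈id x = Fibre.Eq.trans X (reindex-∘≈ f g g∘f≈id x) (reindex-id x)

  module Heyting (I : Implicational D) where
    open Implicational I

    transpose-⇨ : ∀ {A} {x y z : ∣ A ∣} → meet A x y ≤[ A ] z → x ≤[ A ] imp y z
    transpose-⇨ {A} {x} {y} {z} = proj₁ (imp-adj {A} x y z)

    ⇨-eval : ∀ {A} {y z : ∣ A ∣} → meet A (imp y z) y ≤[ A ] z
    ⇨-eval {A} {y} {z} = proj₂ (imp-adj {A} (imp y z) y z) (Fibre.refl A)

    ⊤≤⇨ : ∀ {A} {y z : ∣ A ∣} → y ≤[ A ] z → top A ≤[ A ] imp y z
    ⊤≤⇨ {A} y≤z = transpose-⇨ (trans (x∧y≤y _ _) y≤z)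
      where open Fibre A

    ⇨-relax : ∀ {A} {y y′ z z′ : ∣ A ∣} → y′ ≤[ A ] y → z ≤[ A ] z′ → imp y z ≤[ A ] imp y′ z′
    ⇨-relax {A} y′≤y z≤z′ = transpose-⇨ (trans (∧-monotonic refl y′≤y) (trans ⇨-eval z≤z′))
      where open Fibre A

    ⇨-cong : ∀ {A} {y y′ z z′ : ∣ A ∣} → y ≡[ A ] y′ → z ≡[ A ] z′ → imp y z ≡[ A ] imp y′ z′
    ⇨-cong {A} y≈y′ z≈z′ = antisym (⇨-relax (reflexive (Eq.sym y≈y′)) (reflexive z≈z′))
                                   (⇨-relax (reflexive y≈y′) (reflexive (Eq.sym z≈z′)))
      where open Fibre A

    ⇨-trans : ∀ {A} {x y z : ∣ A ∣} → meet A (imp x y) (imp y z) ≤[ A ] imp x z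
    ⇨-trans {A} = transpose-⇨ (trans (∧-greatest (trans (x∧y≤x _ _) (x∧y≤y _ _))
                                                  (trans (∧-monotonic (x∧y≤x _ _) refl) ⇨-eval))
                                     ⇨-eval)
      where open Fibre A

    ⇨-distribˡ-∧-≥ : ∀ {A} {x y z : ∣ A ∣} → meet A (imp x y) (imp x z) ≤[ A ] imp x (meet A y z)
    ⇨-distribˡ-∧-≥ {A} = transpose-⇨ (∧-greatest (trans (∧-monotonic (x∧y≤x _ _) refl) ⇨-eval)
                                                 (trans (∧-monotonic (x∧y≤y _ _) refl) ⇨-eval))
      where open Fibre A

    ⇨-valid-elim : ∀ {A} {x y z : ∣ A ∣} → top A ≤[ A ] x → y ≤[ A ] imp x z → y ≤[ A ] z
    ⇨-valid-elim {A} ⊤≤x y≤x⇨z = trans (∧-greatest y≤x⇨z (trans (maximum _) ⊤≤x)) ⇨-eval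
      where open Fibre A

    iff : (A : Obj) → ∣ A ∣ → ∣ A ∣ → ∣ A ∣
    iff A x y = meet A (imp x y) (imp y x)

    iff-cong : ∀ {A} {x x′ y y′ : ∣ A ∣} → x ≡[ A ] x′ → y ≡[ A ] y′ → iff A x y ≡[ A ] iff A x′ y′
    iff-cong {A} x≈x′ y≈y′ = Fibre.∧-cong A (⇨-cong x≈x′ y≈y′) (⇨-cong y≈y′ x≈x′)

    reindex-iff : ∀ {A B} (k : Hom A B) (x y : ∣ B ∣) →
                  reindex k (iff B x y) ≡[ A ] iff A (reindex k x) (reindex k y)
    reindex-iff {A} k x y =
      Fibre.Eq.trans A (reindex-∧ k _ _) (Fibre.∧-cong A (imp-reindex k x y) (imp-reindex k y x))

    ≈⇒⊤≤iff : ∀ {A} {x y : ∣ A ∣} → x ≡[ A ] y → top A ≤[ A ] iff A x y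
    ≈⇒⊤≤iff {A} x≈y = ∧-greatest (⊤≤⇨ (reflexive x≈y)) (⊤≤⇨ (reflexive (Eq.sym x≈y)))
      where open Fibre A

    iff-sym : ∀ {A} {x y : ∣ A ∣} → iff A x y ≤[ A ] iff A y x
    iff-sym {A} = ∧-greatest (x∧y≤y _ _) (x∧y≤x _ _)
      where open Fibre A

    iff-trans : ∀ {A} {x y z : ∣ A ∣} → meet A (iff A x y) (iff A y z) ≤[ A ] iff A x z
    iff-trans {A} = ∧-greatest (trans (∧-monotonic (x∧y≤x _ _) (x∧y≤x _ _)) ⇨-trans)
                               (trans (∧-greatest (trans (x∧y≤y _ _) (x∧y≤y _ _))
                                                  (trans (x∧y≤x _ _) (x∧y≤y _ _)))
                                      ⇨-trans)
      where open Fibre A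

    iff-valid-elim : ∀ {A} {x y z : ∣ A ∣} → top A ≤[ A ] x → y ≤[ A ] iff A x z → y ≤[ A ] z
    iff-valid-elim {A} ⊤≤x y≤x⇔z = ⇨-valid-elim ⊤≤x (Fibre.trans A y≤x⇔z (Fibre.x∧y≤x A _ _))

  module Quantifier (U : Universal D) where
    open Universal U

    ∀′-counit : ∀ {X A} (α : ∣ X ⊗ A ∣) → reindex π₁ (∀′ {X} {A} α) ≤[ X ⊗ A ] α
    ∀′-counit {X} {A} α = proj₂ (∀-adj {X} {A} α (∀′ α)) (Fibre.refl X)

    ∀′-intro : ∀ {X A} {α : ∣ X ⊗ A ∣} {β : ∣ X ∣} →
               reindex π₁ β ≤[ X ⊗ A ] α → β ≤[ X ] ∀′ {X} {A} α
    ∀′-intro {X} {A} {α} {β} = proj₁ (∀-adj {X} {A} α β)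

    ∀′-mono : ∀ {X A} {α α′ : ∣ X ⊗ A ∣} → α ≤[ X ⊗ A ] α′ → ∀′ {X} {A} α ≤[ X ] ∀′ {X} {A} α′
    ∀′-mono {X} {A} α≤α′ = ∀′-intro (Fibre.trans (X ⊗ A) (∀′-counit _) α≤α′)

    ∀′-cong : ∀ {X A} {α α′ : ∣ X ⊗ A ∣} → α ≡[ X ⊗ A ] α′ → ∀′ {X} {A} α ≡[ X ] ∀′ {X} {A} α′
    ∀′-cong {X} {A} α≈α′ =
      Fibre.antisym X (∀′-mono (reflexive α≈α′)) (∀′-mono (reflexive (Eq.sym α≈α′)))
      where open Fibre (X ⊗ A)

    ∀′-valid : ∀ {X A} {α : ∣ X ⊗ A ∣} → top (X ⊗ A) ≤[ X ⊗ A ] α → top X ≤[ X ] ∀′ {X} {A} α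
    ∀′-valid {X} {A} ⊤≤α = ∀′-intro (Fibre.trans (X ⊗ A) (Fibre.maximum (X ⊗ A) _) ⊤≤α)

    ∀′-elim : ∀ {X A} (t : Hom X A) (α : ∣ X ⊗ A ∣) → ∀′ {X} {A} α ≤[ X ] reindex ⟨ id , t ⟩ α
    ∀′-elim {X} t α = begin
      ∀′ α                                   ≈⟨ reindex-∘≈id ⟨ id , t ⟩ π₁ π₁∘⟨⟩ (∀′ α) ⟨
      reindex ⟨ id , t ⟩ (reindex π₁ (∀′ α)) ≤⟨ reindex-mono ⟨ id , t ⟩ (∀′-counit α) ⟩
      reindex ⟨ id , t ⟩ α                   ∎
      where open Fibre X

  module Equality (E : Elementary D) where
    open Elementary E

    private
      m : ∀ {X A} → Hom ((X ⊗ A) ⊗ A) (A ⊗ A)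
      m = ⟨ π₂ ∘ π₁ , π₂ ⟩

      m∘⟨id,π₂⟩ : ∀ {X A} → m ∘ ⟨ id , π₂ ⟩ ≈ ⟨ π₂ , π₂ {X} {A} ⟩
      m∘⟨id,π₂⟩ = ⟨⟩∘≈⟨⟩ (≈-trans assoc (≈-trans (∘-resp-≈ ≈-refl π₁∘⟨⟩) identityʳ)) π₂∘⟨⟩

    δ-adj-⊤ : ∀ X A (β : ∣ (X ⊗ A) ⊗ A ∣) →
              (reindex m (δ A) ≤[ (X ⊗ A) ⊗ A ] β) ⇔' (top (X ⊗ A) ≤[ X ⊗ A ] reindex ⟨ id , π₂ ⟩ β)
    δ-adj-⊤ X A β =
        (λ mδ≤β → proj₁ (δ-adj X A (top (X ⊗ A)) β) (trans (x∧y≤y _ _) mδ≤β))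
      , (λ ⊤≤β → trans (∧-greatest (≤-respʳ-≈ (Eq.sym (reindex-⊤ π₁)) (maximum _)) refl)
                       (proj₂ (δ-adj X A (top (X ⊗ A)) β) ⊤≤β))
      where open Fibre ((X ⊗ A) ⊗ A)

    δ-refl : ∀ {X A} (u : Hom X A) → top X ≤[ X ] reindex ⟨ u , u ⟩ (δ A)
    δ-refl {X} {A} u = begin
      top X
        ≤⟨ ⊤≤-reindex ⟨ id , u ⟩ (proj₁ (δ-adj-⊤ X A (reindex m (δ A))) (Fibre.refl _)) ⟩
      reindex ⟨ id , u ⟩ (reindex ⟨ id , π₂ ⟩ (reindex m (δ A)))
        ≈⟨ reindex-cong ⟨ id , u ⟩ (reindex-∘≈ ⟨ id , π₂ ⟩ m m∘⟨id,π₂⟩ (δ A)) ⟩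
      reindex ⟨ id , u ⟩ (reindex ⟨ π₂ , π₂ ⟩ (δ A))
        ≈⟨ reindex-∘≈ ⟨ id , u ⟩ ⟨ π₂ , π₂ ⟩ (⟨⟩∘≈⟨⟩ π₂∘⟨⟩ π₂∘⟨⟩) (δ A) ⟩
      reindex ⟨ u , u ⟩ (δ A)
        ∎
      where open Fibre X

    δ-least : ∀ {Y} (γ : ∣ Y ⊗ Y ∣) → top Y ≤[ Y ] reindex ⟨ id , id ⟩ γ → δ Y ≤[ Y ⊗ Y ] γ
    δ-least {Y} γ γ-diagonal = begin
      δ Y                         ≈⟨ reindex-∘≈id k m m∘k≈id (δ Y) ⟨
      reindex k (reindex m (δ Y)) ≤⟨ reindex-mono k (proj₂ (δ-adj-⊤ Y Y (reindex m γ)) γ-on-y×y) ⟩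
      reindex k (reindex m γ)     ≈⟨ reindex-∘≈id k m m∘k≈id γ ⟩
      γ                           ∎
      where
        open Fibre (Y ⊗ Y)
        k : Hom (Y ⊗ Y) ((Y ⊗ Y) ⊗ Y)
        k = ⟨ ⟨ π₁ , π₁ ⟩ , π₂ ⟩
        m∘k≈id : m ∘ k ≈ id
        m∘k≈id = ≈-trans (⟨⟩∘≈⟨⟩ (≈-trans ∘π₁∘⟨⟩ π₂∘⟨⟩) π₂∘⟨⟩) ⟨π₁,π₂⟩≈id
        γ-on-y×y : top (Y ⊗ Y) ≤[ Y ⊗ Y ] reindex ⟨ id , π₂ ⟩ (reindex m γ)
        γ-on-y×y = ≤-respʳ-≈ (reindex-square π₂ ⟨ id , id ⟩ ⟨ id , π₂ ⟩ m
                               (≈-trans (⟨⟩∘≈⟨⟩ identityˡ identityˡ) (≈-sym m∘⟨id,π₂⟩)) γ)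
                             (⊤≤-reindex π₂ γ-diagonal)

    quotient⇒coequalizer : ComprehensiveDiagonals D E →
      ∀ {A B} {f g : Hom A B} {ρ : ∣ B ⊗ B ∣} → Quotient D E B ρ →
      top A ≤[ A ] reindex ⟨ f , g ⟩ ρ →
      (∀ {Z} (h : Hom B Z) → h ∘ f ≈ h ∘ g → ρ ≤[ B ⊗ B ] reindex (h ⁂ h) (δ Z)) →
      Coequalizer C f g
    quotient⇒coequalizer diagonals {A} {B} {f} {g} {ρ} Q ρ-relates-f-g ρ-below-kernels = record
      { obj        = A/ρ
      ; arr        = quot
      ; equality   = proj₂ (diagonals (quot ∘ f) (quot ∘ g)) (antisym quot-identifies (maximum _))
      ; coequalize = λ h eq → factor h (ρ-below-kernels h eq)
      ; universal  = λ h eq → factor-comm h (ρ-below-kernels h eq)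
      ; unique     = λ h eq → factor-unique h (ρ-below-kernels h eq)
      }
      where
        open Quotient Q
        open Fibre A
        quot-identifies : top A ≤[ A ] reindex ⟨ quot ∘ f , quot ∘ g ⟩ (δ A/ρ)
        quot-identifies = begin
          top A
            ≤⟨ ρ-relates-f-g ⟩
          reindex ⟨ f , g ⟩ ρ
            ≤⟨ reindex-mono ⟨ f , g ⟩ quot-resp ⟩
          reindex ⟨ f , g ⟩ (reindex (quot ⁂ quot) (δ A/ρ))
            ≈⟨ reindex-∘≈ ⟨ f , g ⟩ (quot ⁂ quot) (⟨⟩∘≈⟨⟩ ∘π₁∘⟨⟩ ∘π₂∘⟨⟩) (δ A/ρ) ⟩
          reindex ⟨ quot ∘ f , quot ∘ g ⟩ (δ A/ρ)
            ∎

  module Saturation (E : Elementary D) (I : Implicational D) (U : Universal D)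
                    (Pow : WeakPowerObjects D) {A B : Obj} (f g : Hom A B) where
    open Elementary E
    open Implicational I using (imp; imp-reindex)
    open Universal U
    open WeakPowerObjects Pow
    open Heyting I
    open Quantifier U
    open Equality E

    infix 4 _∈̇_
    _∈̇_ : ∀ {X} → Hom X B → Hom X (𝒫 B) → ∣ X ∣
    u ∈̇ t = reindex ⟨ u , t ⟩ (∈ B)

    reindex-∈̇ : ∀ {Y X} (k : Hom Y X) {u t u′ t′} →
                u ∘ k ≈ u′ → t ∘ k ≈ t′ → reindex k (u ∈̇ t) ≡[ Y ] (u′ ∈̇ t′)
    reindex-∈̇ k {u} {t} u∘k≈u′ t∘k≈t′ = reindex-∘≈ k ⟨ u , t ⟩ (⟨⟩∘≈⟨⟩ u∘k≈u′ t∘k≈t′) (∈ B)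

    saturated : ∣ 𝒫 B ∣
    saturated = ∀′ {𝒫 B} {A} (iff (𝒫 B ⊗ A) ((f ∘ π₂) ∈̇ π₁) ((g ∘ π₂) ∈̇ π₁))

    reindex-saturated : ∀ {X} (t : Hom X (𝒫 B)) →
      reindex t saturated
        ≡[ X ] ∀′ {X} {A} (iff (X ⊗ A) ((f ∘ π₂) ∈̇ (t ∘ π₁)) ((g ∘ π₂) ∈̇ (t ∘ π₁)))
    reindex-saturated {X} t =
      Fibre.Eq.trans X (∀-BC t _)
        (∀′-cong (Fibre.Eq.trans (X ⊗ A) (reindex-iff (t ⁂ id) _ _)
                   (iff-cong (w∘π₂-in-t∘π₁ f) (w∘π₂-in-t∘π₁ g))))
      where
        w∘π₂-in-t∘π₁ : (w : Hom A B) →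
                       reindex (t ⁂ id) ((w ∘ π₂) ∈̇ π₁) ≡[ X ⊗ A ] ((w ∘ π₂) ∈̇ (t ∘ π₁))
        w∘π₂-in-t∘π₁ w = reindex-∈̇ (t ⁂ id) (≈-trans ∘π₂∘⟨⟩ (∘-resp-≈ ≈-refl identityˡ)) π₁∘⟨⟩

    saturated-elim : ∀ {X} (a : Hom X A) (t : Hom X (𝒫 B)) →
                     reindex t saturated ≤[ X ] iff X ((f ∘ a) ∈̇ t) ((g ∘ a) ∈̇ t)
    saturated-elim {X} a t = begin
      reindex t saturated
        ≈⟨ reindex-saturated t ⟩
      ∀′ (iff (X ⊗ A) ((f ∘ π₂) ∈̇ (t ∘ π₁)) ((g ∘ π₂) ∈̇ (t ∘ π₁)))
        ≤⟨ ∀′-elim a _ ⟩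
      reindex ⟨ id , a ⟩ (iff (X ⊗ A) ((f ∘ π₂) ∈̇ (t ∘ π₁)) ((g ∘ π₂) ∈̇ (t ∘ π₁)))
        ≈⟨ Eq.trans (reindex-iff ⟨ id , a ⟩ _ _) (iff-cong (w∘a-in-t f) (w∘a-in-t g)) ⟩
      iff X ((f ∘ a) ∈̇ t) ((g ∘ a) ∈̇ t)
        ∎
      where
        open Fibre X
        w∘a-in-t : (w : Hom A B) → reindex ⟨ id , a ⟩ ((w ∘ π₂) ∈̇ (t ∘ π₁)) ≡[ X ] ((w ∘ a) ∈̇ t)
        w∘a-in-t w = reindex-∈̇ ⟨ id , a ⟩ ∘π₂∘⟨⟩ (≈-trans ∘π₁∘⟨⟩ identityʳ)

    respects : ∀ {X} → Hom X B → Hom X B → Hom X (𝒫 B) → ∣ X ∣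
    respects {X} u v t = imp (reindex t saturated) (iff X (u ∈̇ t) (v ∈̇ t))

    reindex-respects : ∀ {Y X} (k : Hom Y X) {u v t u′ v′ t′} →
                       u ∘ k ≈ u′ → v ∘ k ≈ v′ → t ∘ k ≈ t′ →
                       reindex k (respects u v t) ≡[ Y ] respects u′ v′ t′
    reindex-respects {Y} k {t = t} u∘k≈u′ v∘k≈v′ t∘k≈t′ =
      Eq.trans (imp-reindex k _ _)
        (⇨-cong (reindex-∘≈ k t t∘k≈t′ saturated)
                (Eq.trans (reindex-iff k _ _)
                          (iff-cong (reindex-∈̇ k u∘k≈u′ t∘k≈t′) (reindex-∈̇ k v∘k≈v′ t∘k≈t′))))
      where open Fibre Y

    respects-trans : ∀ {X} (u v w : Hom X B) (t : Hom X (𝒫 B)) →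
                     meet X (respects u v t) (respects v w t) ≤[ X ] respects u w t
    respects-trans {X} u v w t = Fibre.trans X ⇨-distribˡ-∧-≥ (⇨-relax (Fibre.refl X) iff-trans)

    related : ∀ {X} → Hom X B → Hom X B → ∣ X ∣
    related {X} u v = ∀′ {X} {𝒫 B} (respects (u ∘ π₁) (v ∘ π₁) π₂)

    reindex-related : ∀ {Y X} (k : Hom Y X) {u v u′ v′} →
                      u ∘ k ≈ u′ → v ∘ k ≈ v′ → reindex k (related u v) ≡[ Y ] related u′ v′
    reindex-related {Y} k u∘k≈u′ v∘k≈v′ =
      Fibre.Eq.trans Y (∀-BC k _)
        (∀′-cong (reindex-respects (k ⁂ id) (∘π₁∘k⁂id u∘k≈u′) (∘π₁∘k⁂id v∘k≈v′)
                                   (≈-trans π₂∘⟨⟩ identityˡ)))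
      where
        ∘π₁∘k⁂id : ∀ {u u′} → u ∘ k ≈ u′ → (u ∘ π₁) ∘ (k ⁂ id {𝒫 B}) ≈ u′ ∘ π₁
        ∘π₁∘k⁂id u∘k≈u′ = ≈-trans ∘π₁∘⟨⟩ (≈-trans (≈-sym assoc) (∘-resp-≈ u∘k≈u′ ≈-refl))

    related-elim : ∀ {X} (u v : Hom X B) (t : Hom X (𝒫 B)) → related u v ≤[ X ] respects u v t
    related-elim {X} u v t =
      Fibre.≤-respʳ-≈ X (reindex-respects ⟨ id , t ⟩ ∘π₁∘⟨id,t⟩ ∘π₁∘⟨id,t⟩ π₂∘⟨⟩) (∀′-elim t _)
      where
        ∘π₁∘⟨id,t⟩ : ∀ {w : Hom X B} → (w ∘ π₁) ∘ ⟨ id , t ⟩ ≈ w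
        ∘π₁∘⟨id,t⟩ = ≈-trans ∘π₁∘⟨⟩ identityʳ

    related-refl : ∀ {X} (u : Hom X B) → top X ≤[ X ] related u u
    related-refl {X} u = ∀′-valid (⊤≤⇨ (trans (maximum _) (≈⇒⊤≤iff Eq.refl)))
      where open Fibre (X ⊗ 𝒫 B)

    related-sym : ∀ {X} (u v : Hom X B) → related u v ≤[ X ] related v u
    related-sym {X} u v = ∀′-mono (⇨-relax (Fibre.refl (X ⊗ 𝒫 B)) iff-sym)

    related-trans : ∀ {X} (u v w : Hom X B) → meet X (related u v) (related v w) ≤[ X ] related u w
    related-trans {X} u v w = ∀′-intro (begin
      reindex π₁ (meet X (related u v) (related v w))
        ≈⟨ reindex-∧ π₁ _ _ ⟩
      meet (X ⊗ 𝒫 B) (reindex π₁ (related u v)) (reindex π₁ (related v w))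
        ≤⟨ ∧-monotonic (∀′-counit _) (∀′-counit _) ⟩
      meet (X ⊗ 𝒫 B) (respects (u ∘ π₁) (v ∘ π₁) π₂) (respects (v ∘ π₁) (w ∘ π₁) π₂)
        ≤⟨ respects-trans _ _ _ _ ⟩
      respects (u ∘ π₁) (w ∘ π₁) π₂
        ∎)
      where open Fibre (X ⊗ 𝒫 B)

    ρ : ∣ B ⊗ B ∣
    ρ = related π₁ π₂

    reindex-ρ : ∀ {X} (u v : Hom X B) → reindex ⟨ u , v ⟩ ρ ≡[ X ] related u v
    reindex-ρ u v = reindex-related ⟨ u , v ⟩ π₁∘⟨⟩ π₂∘⟨⟩

    ρ-isPEquivalence : IsPEquivalence D E B ρ
    ρ-isPEquivalence = record
      { reflexive  = δ-least ρ (B.≤-respʳ-≈ (B.Eq.sym (reindex-ρ id id)) (related-refl id))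
      ; symmetric  = B×B.≤-respʳ-≈ (B×B.Eq.sym (reindex-ρ π₂ π₁)) (related-sym π₁ π₂)
      ; transitive = begin
          meet ((B ⊗ B) ⊗ B) (reindex π₁ ρ) (reindex ⟨ π₂ ∘ π₁ , π₂ ⟩ ρ)
            ≈⟨ ∧-cong (reindex-related π₁ ≈-refl ≈-refl) (reindex-ρ _ _) ⟩
          meet ((B ⊗ B) ⊗ B) (related (π₁ ∘ π₁) (π₂ ∘ π₁)) (related (π₂ ∘ π₁) π₂)
            ≤⟨ related-trans _ _ _ ⟩
          related (π₁ ∘ π₁) π₂
            ≈⟨ reindex-ρ _ _ ⟨
          reindex ⟨ π₁ ∘ π₁ , π₂ ⟩ ρ
            ∎
      }
      where
        module B = Fibre B
        module B×B = Fibre (B ⊗ B)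
        open Fibre ((B ⊗ B) ⊗ B)

    ρ-relates-f-g : top A ≤[ A ] reindex ⟨ f , g ⟩ ρ
    ρ-relates-f-g =
      Fibre.≤-respʳ-≈ A (Fibre.Eq.sym A (reindex-ρ f g)) (∀′-valid (⊤≤⇨ (saturated-elim π₁ π₂)))

    module KernelClass {Z} (h : Hom B Z) where
      class : Hom B (𝒫 B)
      class = proj₁ (classify (reindex ⟨ h ∘ π₂ , h ∘ π₁ ⟩ (δ Z)))

      ∈-class : ∀ {X} (u v : Hom X B) → (u ∈̇ class ∘ v) ≡[ X ] reindex ⟨ h ∘ v , h ∘ u ⟩ (δ Z)
      ∈-class {X} u v = begin-equality
        (u ∈̇ class ∘ v)
          ≈⟨ (reindex-∈̇ ⟨ u , v ⟩ (≈-trans ∘π₁∘⟨⟩ identityˡ) ∘π₂∘⟨⟩) ⟨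
        reindex ⟨ u , v ⟩ (reindex (id ⁂ class) (∈ B))
          ≈⟨ (reindex-cong ⟨ u , v ⟩ (proj₂ (classify _))) ⟨
        reindex ⟨ u , v ⟩ (reindex ⟨ h ∘ π₂ , h ∘ π₁ ⟩ (δ Z))
          ≈⟨ (reindex-∘≈ ⟨ u , v ⟩ ⟨ h ∘ π₂ , h ∘ π₁ ⟩ (⟨⟩∘≈⟨⟩ ∘π₂∘⟨⟩ ∘π₁∘⟨⟩) (δ Z)) ⟩
        reindex ⟨ h ∘ v , h ∘ u ⟩ (δ Z)
          ∎
        where open Fibre X

      class-saturated : h ∘ f ≈ h ∘ g → top B ≤[ B ] reindex class saturated
      class-saturated hf≈hg = begin
        top B
          ≤⟨ ∀′-valid (≈⇒⊤≤iff f∘π₂-class≈g∘π₂-class) ⟩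
        ∀′ (iff (B ⊗ A) ((f ∘ π₂) ∈̇ (class ∘ π₁)) ((g ∘ π₂) ∈̇ (class ∘ π₁)))
          ≈⟨ reindex-saturated class ⟨
        reindex class saturated
          ∎
        where
          open Fibre B
          hf∘π₂≈hg∘π₂ : h ∘ (f ∘ π₂) ≈ h ∘ (g ∘ π₂)
          hf∘π₂≈hg∘π₂ = ≈-trans (≈-sym assoc) (≈-trans (∘-resp-≈ hf≈hg ≈-refl) assoc)
          f∘π₂-class≈g∘π₂-class : ((f ∘ π₂) ∈̇ class ∘ π₁) ≡[ B ⊗ A ] ((g ∘ π₂) ∈̇ class ∘ π₁)
          f∘π₂-class≈g∘π₂-class =
            Fibre.Eq.trans (B ⊗ A) (∈-class (f ∘ π₂) π₁)
              (Fibre.Eq.trans (B ⊗ A) (reindex-resp (δ Z) (⟨⟩-cong ≈-refl hf∘π₂≈hg∘π₂))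
                                      (Fibre.Eq.sym (B ⊗ A) (∈-class (g ∘ π₂) π₁)))

    ρ-below-kernel : ∀ {Z} (h : Hom B Z) → h ∘ f ≈ h ∘ g → ρ ≤[ B ⊗ B ] reindex (h ⁂ h) (δ Z)
    -- Instantiate ρ(x , y) at the class of x: it is saturated and contains x, hence y.
    ρ-below-kernel {Z} h hf≈hg =
      ≤-respʳ-≈ (∈-class π₂ π₁)
        (iff-valid-elim π₁-in-own-class
          (⇨-valid-elim own-class-saturated (related-elim π₁ π₂ (class ∘ π₁))))
      where
        open Fibre (B ⊗ B)
        open KernelClass h
        own-class-saturated : top (B ⊗ B) ≤[ B ⊗ B ] reindex (class ∘ π₁) saturated
        own-class-saturated = ≤-respʳ-≈ (reindex-∘≈ π₁ class ≈-refl saturated)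
                                        (⊤≤-reindex π₁ (class-saturated hf≈hg))
        π₁-in-own-class : top (B ⊗ B) ≤[ B ⊗ B ] (π₁ ∈̇ class ∘ π₁)
        π₁-in-own-class = ≤-respʳ-≈ (Eq.sym (∈-class π₁ π₁)) (δ-refl (h ∘ π₁))

lemma8p6 : ∀ {o ℓ e p q r : Level} (C : Category o ℓ e) (Pr : FiniteProducts C)
             (D : PrimaryDoctrine C Pr p q r) (T : Tripos D) →
             ComprehensiveDiagonals D (Tripos.elementary T) →
             HasEffectiveQuotients D (Tripos.elementary T) →
             HasCoequalizers C
lemma8p6 C Pr D T diagonals quotients {B = B} f g =
  quotient⇒coequalizer diagonals quotient ρ-relates-f-g ρ-below-kernel
  where
    open Tripos T
    open Doctrine D
    open Equality elementary
    open Saturation elementary implicational universal weakPower f g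
    quotient : Quotient D elementary B ρ
    quotient = proj₁ (quotients B ρ ρ-isPEquivalence)
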